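{- Let $k\ge4$ be an integer, $G=([N],E)$ a graph, and $S$ a $k$-spot of $G$. Then the diameter of the induced subgraph $G_S$ is smaller than $k/2$.
   Context: For $S\subseteq[N]$, $G_S$ is the subgraph induced by $S$. A set $S\subseteq[N]$ is a $k$-spot of $G$ if: (1) $G_S$ contains no simple cycle of length at least $k$; (2) $|S|\ge3$ and $G_S$ is 2-vertex-connected (every two vertices of $G_S$ are joined by two internally vertex-disjoint paths in $G_S$); (3) for all distinct $u,v\in S$, every path in $G$ from $u$ to $v$ all of whose intermediate vertices lie in $[N]\setminus S$ (a path external to $G_S$), if any exists, has length at least $2k$. -}

module Defs where

open import Data.Nat using (ℕ; zero; suc; _+_; _*_; _≤_; _<_)
open import Data.Fin using (Fin)
open import Data.Fin.Subset using (Subset; _∈_; _∉_; ∣_∣)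
open import Data.List using (List; []; _∷_; length)
open import Data.List.Relation.Unary.All using (All)
open import Data.List.Relation.Unary.Unique.Propositional using (Unique)
import Data.List.Membership.Propositional as LM
open import Data.Product using (Σ; _×_; _,_; ∃)
open import Relation.Binary.PropositionalEquality using (_≡_; _≢_)
open import Relation.Nullary using (¬_)
open import Level using (0ℓ)

record Graph (N : ℕ) : Set₁ where
  field
    Adj   : Fin N → Fin N → Set
    sym   : ∀ {u v} → Adj u v → Adj v u
    irrefl : ∀ {u} → ¬ Adj u u
open Graph public

module _ {N : ℕ} (G : Graph N) where

  data Walk : Fin N → Fin N → Set where
    []  : ∀ {u} → Walk u u
    _∷_ : ∀ {u w v} → Adj G u w → Walk w v → Walk u v

  len : ∀ {u v} → Walk u v → ℕ
  len []      = 0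
  len (_ ∷ p) = suc (len p)

  vertices : ∀ {u v} → Walk u v → List (Fin N)
  vertices {u} []      = u ∷ []
  vertices {u} (_ ∷ p) = u ∷ vertices p

  inner : ∀ {u v} → Walk u v → List (Fin N)
  inner []                        = []
  inner (_ ∷ [])                  = []
  inner (_∷_ {w = w} _ (e ∷ p))   = w ∷ inner (e ∷ p)

  IsPath : ∀ {u v} → Walk u v → Set
  IsPath p = Unique (vertices p)

  IsPathIn : (S : Subset N) → ∀ {u v} → Walk u v → Set
  IsPathIn S p = IsPath p × All (_∈ S) (vertices p)

  -- A simple cycle of G_S of length m (m ≥ 3): distinct vertices
  -- x₀ … x_{m-1} in S, consecutive adjacent, and x_{m-1} adjacent to x₀.
  -- Encoded as a path x₀ → x_{m-1} of length m-1 ≥ 2 plus the closing edge.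
  HasCycleOfLengthAtLeast : (S : Subset N) → ℕ → Set
  HasCycleOfLengthAtLeast S k =
    Σ (Fin N) λ u → Σ (Fin N) λ v → Σ (Walk u v) λ p →
      IsPathIn S p × 2 ≤ len p × Adj G v u × k ≤ suc (len p)

  -- 2-vertex-connectivity of G_S (with |S| ≥ 3 stated separately):
  -- every two distinct vertices are joined by two distinct, internally
  -- vertex-disjoint paths of G_S.
  TwoConnected : Subset N → Set
  TwoConnected S =
    ∀ u v → u ∈ S → v ∈ S → u ≢ v →
      Σ (Walk u v) λ p → Σ (Walk u v) λ q →
        IsPathIn S p × IsPathIn S q × p ≢ q ×
        All (λ x → ¬ (x LM.∈ inner q)) (inner p)

  -- a path of G external to G_S: a path of G whose intermediate vertices
  -- all lie outside S, with at least one intermediate vertex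
  -- (i.e. not an edge of the induced subgraph G_S).
  IsExternalPath : (S : Subset N) → ∀ {u v} → Walk u v → Set
  IsExternalPath S p = IsPath p × 2 ≤ len p × All (_∉ S) (inner p)

  record IsSpot (k : ℕ) (S : Subset N) : Set where
    field
      noLongCycle : ¬ HasCycleOfLengthAtLeast S k
      size≥3      : 3 ≤ ∣ S ∣
      twoConn     : TwoConnected S
      externalLong : ∀ u v → u ∈ S → v ∈ S → u ≢ v →
                     (p : Walk u v) → IsExternalPath S p → 2 * k ≤ len p

  -- diam(G_S) < r/2 : every two vertices of S are at distance < r/2 in G_S,
  -- i.e. joined by a path of G_S of length d with 2d < r.
  DiameterBelowHalf : Subset N → ℕ → Set
  DiameterBelowHalf S r =
    ∀ u v → u ∈ S → v ∈ S →
      Σ (Walk u v) λ p → IsPathIn S p × 2 * len p < r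

module Submission where

-- For u = v the trivial path works since k > 0.  For u ≠ v,
-- 2-connectivity of G_S gives two internally vertex-disjoint u–v paths
-- p, q in G_S.  Following p from u to v and then q backwards from v to u
-- traces a simple cycle of G_S of length |p| + |q|.  If both paths had
-- 2·length ≥ k this cycle would have length ≥ k, which a k-spot forbids;
-- hence one of p, q is short enough.  Only conditions (1) and (2) of a
-- k-spot are used.

open import Defs hiding (sym)
open import Data.Nat using (ℕ; suc; _+_; _*_; _≤_; z≤n; s≤s; _<?_)
open import Data.Nat.Properties
  using (+-suc; +-comm; +-identityʳ; +-mono-≤; ≤-reflexive; ≤-trans; *-cancelˡ-≤; *-distribˡ-+; ≮⇒≥; m≤n+m; module ≤-Reasoning)
open import Data.Fin using (Fin)
open import Data.Fin.Properties using (_≟_)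
open import Data.Fin.Subset using (Subset; _∈_)
open import Data.List using (List; []; _∷_; _++_; [_])
open import Data.List.Relation.Unary.All using (All; []; _∷_; lookup)
open import Data.List.Relation.Unary.All.Properties using (++⁻ˡ; ++⁻ʳ; ++⁺)
open import Data.List.Relation.Unary.Any using (here; there)
open import Data.List.Relation.Unary.Unique.Propositional using (Unique)
import Data.List.Relation.Unary.Unique.Propositional.Properties as UniqueProps
open import Data.List.Relation.Unary.AllPairs using ([]; _∷_)
open import Data.List.Relation.Binary.Disjoint.Propositional using (Disjoint)
open import Data.List.Membership.Propositional using () renaming (_∈_ to _∈ₗ_)
open import Data.List.Membership.Propositional.Properties using (∈-++⁻)
open import Data.List.Relation.Binary.Permutation.Propositional
  using (_↭_; ↭-refl; ↭-sym; ↭-trans; ↭-reflexive; ↭⇒↭ₛ)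
open import Data.List.Relation.Binary.Permutation.Propositional.Properties
  using (All-resp-↭; shift; ++-comm; ++⁺ˡ)
import Data.List.Relation.Binary.Permutation.Setoid.Properties as SetoidPerm
open import Data.Product using (_,_)
open import Data.Sum using (inj₁; inj₂)
open import Relation.Binary.PropositionalEquality
  using (_≡_; _≢_; refl; cong; subst; setoid)
  renaming (sym to ≡-sym; trans to ≡-trans)
open import Relation.Nullary using (¬_; yes; no)
open import Data.Empty using (⊥-elim)

module Lists {A : Set} where

  unique-resp-↭ : {xs ys : List A} → xs ↭ ys → Unique xs → Unique ys
  unique-resp-↭ xs↭ys = SetoidPerm.Unique-resp-↭ (setoid A) (↭⇒↭ₛ xs↭ys)

  unique-++ˡ : ∀ (xs : List A) {ys} → Unique (xs ++ ys) → Unique xs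
  unique-++ˡ []       _          = []
  unique-++ˡ (x ∷ xs) (x∉ ∷ xs!) = ++⁻ˡ xs x∉ ∷ unique-++ˡ xs xs!

  unique-++-disjoint : ∀ (xs : List A) {ys} → Unique (xs ++ ys) → Disjoint xs ys
  unique-++-disjoint (x ∷ xs) (x∉ ∷ _)  (here refl , y∈ys) = lookup (++⁻ʳ xs x∉) y∈ys refl
  unique-++-disjoint (x ∷ xs) (_ ∷ xs!) (there y∈xs , y∈ys) =
    unique-++-disjoint xs xs! (y∈xs , y∈ys)

  -- This is the vertex list of the cycle obtained by gluing the paths.
  glued-unique : ∀ {u v : A} {I J : List A} →
    Unique (u ∷ I ++ [ v ]) → Unique (u ∷ J ++ [ v ]) → Disjoint I J →
    Unique (J ++ u ∷ I ++ [ v ])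
  glued-unique {u} {v} {I} {J} uIv! (u∉Jv ∷ Jv!) I#J =
    UniqueProps.++⁺ (unique-++ˡ J Jv!) uIv! J#uIv
    where
    J#uIv : Disjoint J (u ∷ I ++ [ v ])
    J#uIv (x∈J , here refl)  = lookup (++⁻ˡ J u∉Jv) x∈J refl
    J#uIv (x∈J , there x∈Iv) with ∈-++⁻ I x∈Iv
    ... | inj₁ x∈I         = I#J (x∈I , x∈J)
    ... | inj₂ (here refl) = unique-++-disjoint J Jv! (x∈J , here refl)

open Lists

module Walks {N : ℕ} (G : Graph N) where

  initV : ∀ {a b} → Walk G a b → List (Fin N)
  initV []            = []
  initV {a} (_ ∷ p)   = a ∷ initV p

  vertices-initV : ∀ {a b} (p : Walk G a b) → vertices G p ≡ initV p ++ [ b ]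
  vertices-initV []          = refl
  vertices-initV {a} (_ ∷ p) = cong (a ∷_) (vertices-initV p)

  inner-∷ : ∀ {a w b} (e : Adj G a w) (p : Walk G w b) → inner G (e ∷ p) ≡ initV p
  inner-∷ e []                 = refl
  inner-∷ {w = w} e (e′ ∷ p)   = cong (w ∷_) (inner-∷ e′ p)

  vertices-∷ : ∀ {a w b} (e : Adj G a w) (p : Walk G w b) →
    vertices G (e ∷ p) ≡ a ∷ inner G (e ∷ p) ++ [ b ]
  vertices-∷ {a} e p =
    cong (a ∷_) (≡-trans (vertices-initV p) (cong (_++ [ _ ]) (≡-sym (inner-∷ e p))))

  _++w_ : ∀ {a b c} → Walk G a b → Walk G b c → Walk G a c
  []      ++w q = q
  (e ∷ p) ++w q = e ∷ (p ++w q)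

  vertices-++w : ∀ {a b c} (p : Walk G a b) (q : Walk G b c) →
    vertices G (p ++w q) ≡ initV p ++ vertices G q
  vertices-++w []          q = refl
  vertices-++w {a} (_ ∷ p) q = cong (a ∷_) (vertices-++w p q)

  len-++w : ∀ {a b c} (p : Walk G a b) (q : Walk G b c) →
    len G (p ++w q) ≡ len G p + len G q
  len-++w []      q = refl
  len-++w (_ ∷ p) q = cong suc (len-++w p q)

  revOnto : ∀ {a b c} → Walk G a b → Walk G a c → Walk G b c
  revOnto []      acc = acc
  revOnto (e ∷ p) acc = revOnto p (Graph.sym G e ∷ acc)

  rev : ∀ {a b} → Walk G a b → Walk G b a
  rev p = revOnto p []

  tailV : ∀ {a b} → Walk G a b → List (Fin N)
  tailV []      = []
  tailV (_ ∷ p) = vertices G p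

  vertices-tailV : ∀ {a b} (p : Walk G a b) → vertices G p ≡ a ∷ tailV p
  vertices-tailV []      = refl
  vertices-tailV (_ ∷ p) = refl

  vertices-revOnto : ∀ {a b c} (p : Walk G a b) (acc : Walk G a c) →
    vertices G (revOnto p acc) ↭ tailV p ++ vertices G acc
  vertices-revOnto []                  acc = ↭-refl
  vertices-revOnto (_∷_ {w = x} e p) acc =
    ↭-trans (vertices-revOnto p (Graph.sym G e ∷ acc))
      (subst (λ l → tailV p ++ x ∷ vertices G acc ↭ l ++ vertices G acc)
        (≡-sym (vertices-tailV p)) (shift x (tailV p) (vertices G acc)))

  len-revOnto : ∀ {a b c} (p : Walk G a b) (acc : Walk G a c) →
    len G (revOnto p acc) ≡ len G p + len G acc
  len-revOnto []      acc = refl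
  len-revOnto (e ∷ p) acc = ≡-trans (len-revOnto p _) (+-suc (len G p) (len G acc))

  vertices-rev : ∀ {a b} (p : Walk G a b) → vertices G (rev p) ↭ vertices G p
  vertices-rev {a} p = ↭-trans (vertices-revOnto p [])
    (↭-trans (++-comm (tailV p) [ a ]) (↭-reflexive (≡-sym (vertices-tailV p))))

  len-rev : ∀ {a b} (p : Walk G a b) → len G (rev p) ≡ len G p
  len-rev p = ≡-trans (len-revOnto p []) (+-comm (len G p) 0)

  -- Two internally vertex-disjoint paths of G_S between distinct vertices
  -- form a simple cycle of G_S of length |p| + |q| (when that is ≥ 3):
  -- with q = u →e w ⋯ v, the cycle is the path w ⋯ v ⋯ u (rest of q, then
  -- p reversed) closed by the edge e.
  glueCycle : ∀ (S : Subset N) {u v} → u ≢ v → (p q : Walk G u v) →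
    IsPathIn G S p → IsPathIn G S q →
    All (λ x → ¬ (x ∈ₗ inner G q)) (inner G p) →
    3 ≤ len G p + len G q → HasCycleOfLengthAtLeast G S (len G p + len G q)
  glueCycle S u≢v [] q _ _ _ _ = ⊥-elim (u≢v refl)
  glueCycle S u≢v (_ ∷ _) [] _ _ _ _ = ⊥-elim (u≢v refl)
  glueCycle S {u} {v} u≢v p@(f ∷ p′) q@(_∷_ {w = w} e q′) (p! , p⊆S) (q! , q⊆S) p#q long =
    w , u , C , (C! , C⊆S) , two≤|C| , e , |p|+|q|≤suc|C|
    where
    C : Walk G w u
    C = q′ ++w rev p

    C↭ : vertices G C ↭ inner G q ++ u ∷ inner G p ++ [ v ]
    C↭ = ↭-trans
      (↭-reflexive (≡-trans (vertices-++w q′ (rev p))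
                            (cong (_++ vertices G (rev p)) (≡-sym (inner-∷ e q′)))))
      (++⁺ˡ (inner G q) (↭-trans (vertices-rev p) (↭-reflexive (vertices-∷ f p′))))

    C! : Unique (vertices G C)
    C! = unique-resp-↭ (↭-sym C↭)
      (glued-unique (subst Unique (vertices-∷ f p′) p!)
                    (subst Unique (vertices-∷ e q′) q!)
                    (λ (x∈p , x∈q) → lookup p#q x∈p x∈q))

    C⊆S : All (_∈ S) (vertices G C)
    C⊆S with subst (All (_∈ S)) (vertices-∷ e q′) q⊆S
    ... | _ ∷ q°⊆S = All-resp-↭ (↭-sym C↭)
      (++⁺ (++⁻ˡ (inner G q) q°⊆S) (subst (All (_∈ S)) (vertices-∷ f p′) p⊆S))

    suc|C| : suc (len G C) ≡ len G p + len G q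
    suc|C| = ≡-trans (cong suc (≡-trans (len-++w q′ (rev p)) (cong (len G q′ +_) (len-rev p))))
                     (+-comm (suc (len G q′)) (len G p))

    |p|+|q|≤suc|C| : len G p + len G q ≤ suc (len G C)
    |p|+|q|≤suc|C| = ≤-reflexive (≡-sym suc|C|)

    two≤|C| : 2 ≤ len G C
    two≤|C| with subst (3 ≤_) (≡-sym suc|C|) long
    ... | s≤s h = h

  cycle-mono : ∀ {S m n} → m ≤ n → HasCycleOfLengthAtLeast G S n → HasCycleOfLengthAtLeast G S m
  cycle-mono m≤n (u , v , c , c-path , two , closing , n≤) =
    u , v , c , c-path , two , closing , ≤-trans m≤n n≤

open Walks

sum-of-halves : ∀ k a b → k ≤ 2 * a → k ≤ 2 * b → k ≤ a + b
sum-of-halves k a b k≤2a k≤2b = *-cancelˡ-≤ 2 (begin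
  2 * k           ≡⟨ cong (k +_) (+-identityʳ k) ⟩
  k + k           ≤⟨ +-mono-≤ k≤2a k≤2b ⟩
  2 * a + 2 * b   ≡⟨ ≡-sym (*-distribˡ-+ 2 a b) ⟩
  2 * (a + b)     ∎)
  where open ≤-Reasoning

claim5p2 : (k N : ℕ) → 4 ≤ k → (G : Graph N) → (S : Subset N) →
    IsSpot G k S → DiameterBelowHalf G S k
claim5p2 k N 4≤k G S spot u v u∈S v∈S with u ≟ v
... | yes refl = [] , ([] ∷ [] , u∈S ∷ []) , ≤-trans (s≤s z≤n) 4≤k
... | no u≢v with IsSpot.twoConn spot u v u∈S v∈S u≢v
... | p , q , p-path , q-path , _ , p#q with 2 * len G p <? k | 2 * len G q <? k
...   | yes p-short | _           = p , p-path , p-short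
...   | no _        | yes q-short = q , q-path , q-short
...   | no p-long   | no q-long   =
  ⊥-elim (IsSpot.noLongCycle spot (cycle-mono G k≤|p|+|q|
    (glueCycle G S u≢v p q p-path q-path p#q (≤-trans (m≤n+m 3 1) (≤-trans 4≤k k≤|p|+|q|)))))
  where
  k≤|p|+|q| : k ≤ len G p + len G q
  k≤|p|+|q| = sum-of-halves k (len G p) (len G q) (≮⇒≥ p-long) (≮⇒≥ q-long)
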